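{- For all nonnegative integers $m,n$: \[ M_{h,m}^{(3)}M_{H,n+1}^{(3)}=M_{H,n+1}^{(3)}M_{h,m}^{(3)}=M_{H,m+n+1}^{(3)} \quad\text{and}\quad \left(M_{H,n+1}^{(3)}\right)^{m}=\left(M_{H,1}^{(3)}\right)^{m}M_{h,mn}^{(3)}. \]
   Context: Let $r,s,t,a,b,c$ be real numbers with $t\neq0$ (the paper also assumes throughout that $\Delta=\frac{r^{3}t}{27}-\frac{r^{2}s^{2}}{108}+\frac{rst}{6}-\frac{s^{3}}{27}+\frac{t^{2}}{4}>0$). The third-order Horadam matrix sequence $(M_{H,n}^{(3)})_{n\ge0}$ of $3\times3$ matrices is defined by $M_{H,n+3}^{(3)}=rM_{H,n+2}^{(3)}+sM_{H,n+1}^{(3)}+tM_{H,n}^{(3)}$ ($n\ge0$) with $M_{H,0}^{(3)}=\begin{bmatrix} b& c-rb& ta\\ a& b-ra& c-rb-sa\\ \frac1t(c-rb-sa)& \frac1t\left(ta-r(c-rb-sa)\right)& \frac1t\left(-sc+(t+rs)b+(s^2-rt)a\right)\end{bmatrix}$, $M_{H,1}^{(3)}=\begin{bmatrix} c& sb+ta& tb\\ b& c-rb& ta\\ a& b-ra& c-rb-sa\end{bmatrix}$, $M_{H,2}^{(3)}=\begin{bmatrix} rc+sb+ta& sc+tb& tc\\ c& sb+ta& tb\\ b& c-rb& ta\end{bmatrix}$. The generalized Tribonacci matrix sequence $(M_{h,n}^{(3)})_{n\ge0}$ satisfies $M_{h,n+3}^{(3)}=rM_{h,n+2}^{(3)}+sM_{h,n+1}^{(3)}+tM_{h,n}^{(3)}$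 with $M_{h,0}^{(3)}=I_3$, $M_{h,1}^{(3)}=\begin{bmatrix} r&s&t\\1&0&0\\0&1&0\end{bmatrix}$, $M_{h,2}^{(3)}=\begin{bmatrix} r^2+s& rs+t& rt\\ r&s&t\\ 1&0&0\end{bmatrix}$. For a square matrix $X$, $X^0=I_3$. -}

module Defs where

open import Level using (_⊔_)
open import Data.Nat using (ℕ; zero; suc)
open import Data.Fin using (Fin; zero; suc)
open import Data.Product using (_×_)
open import Algebra.Bundles using (CommutativeRing)

-- 3×3 matrices over a commutative ring R (which plays the role of ℝ),
-- and the Horadam / generalized Tribonacci matrix sequences of the paper.
-- Parameters: r s t a b c, and tinv, a chosen inverse of t (t ≠ 0 in ℝ).
module Horadam {c₀ ℓ} (R : CommutativeRing c₀ ℓ)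
  (r s t tinv a b c : CommutativeRing.Carrier R) where

  open CommutativeRing R hiding (zero)

  Mat : Set c₀
  Mat = Fin 3 → Fin 3 → Carrier

  mat : Carrier → Carrier → Carrier →
        Carrier → Carrier → Carrier →
        Carrier → Carrier → Carrier → Mat
  mat x00 x01 x02 x10 x11 x12 x20 x21 x22 = λ where
    zero zero → x00
    zero (suc zero) → x01
    zero (suc (suc zero)) → x02
    (suc zero) zero → x10
    (suc zero) (suc zero) → x11
    (suc zero) (suc (suc zero)) → x12
    (suc (suc zero)) zero → x20
    (suc (suc zero)) (suc zero) → x21
    (suc (suc zero)) (suc (suc zero)) → x22

  _≋_ : Mat → Mat → Set ℓ
  X ≋ Y = ∀ i j → X i j ≈ Y i j
  infix 4 _≋_

  _⊕_ : Mat → Mat → Mat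
  (X ⊕ Y) i j = X i j + Y i j

  _·_ : Carrier → Mat → Mat
  (k · X) i j = k * X i j

  _⊗_ : Mat → Mat → Mat
  (X ⊗ Y) i j = X i zero * Y zero j
              + X i (suc zero) * Y (suc zero) j
              + X i (suc (suc zero)) * Y (suc (suc zero)) j

  infixl 6 _⊕_
  infixl 7 _⊗_ _·_

  I₃ : Mat
  I₃ = mat 1# 0# 0# 0# 1# 0# 0# 0# 1#

  _^_ : Mat → ℕ → Mat
  X ^ zero = I₃
  X ^ suc m = (X ^ m) ⊗ X

  rec3 : Mat → Mat → Mat → ℕ → Mat
  rec3 M0 M1 M2 zero = M0
  rec3 M0 M1 M2 (suc zero) = M1
  rec3 M0 M1 M2 (suc (suc zero)) = M2
  rec3 M0 M1 M2 (suc (suc (suc n))) =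
    r · rec3 M0 M1 M2 (suc (suc n)) ⊕ s · rec3 M0 M1 M2 (suc n) ⊕ t · rec3 M0 M1 M2 n

  MH0 MH1 MH2 : Mat
  MH0 = mat b (c - r * b) (t * a)
            a (b - r * a) (c - r * b - s * a)
            (tinv * (c - r * b - s * a))
            (tinv * (t * a - r * (c - r * b - s * a)))
            (tinv * (- (s * c) + (t + r * s) * b + (s * s - r * t) * a))
  MH1 = mat c (s * b + t * a) (t * b)
            b (c - r * b) (t * a)
            a (b - r * a) (c - r * b - s * a)
  MH2 = mat (r * c + s * b + t * a) (s * c + t * b) (t * c)
            c (s * b + t * a) (t * b)
            b (c - r * b) (t * a)

  MH : ℕ → Mat
  MH = rec3 MH0 MH1 MH2

  Mh0 Mh1 Mh2 : Mat
  Mh0 = I₃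
  Mh1 = mat r s t 1# 0# 0# 0# 1# 0#
  Mh2 = mat (r * r + s) (r * s + t) (r * t) r s t 1# 0# 0#

  Mh : ℕ → Mat
  Mh = rec3 Mh0 Mh1 Mh2

module Submission where

-- Let W = Mh1, the companion matrix of x³ - r x² - s x - t, and P = MH1. Both matrix sequences
-- satisfy the recurrence, so they are determined by three initial terms; comparing these gives
-- Mh n = W ^ n and MH (n + 1) = P W ^ n. The initial comparisons, and P W = W P, are finitely
-- many polynomial identities (together with t tinv = 1 for the term t MH0 of MH3), decided by
-- normalising the same matrices built over ℤ[r, s, t, tinv, a, b, c]. Since P commutes with W,
-- the theorem reduces to the laws of exponents W ^ m P W ^ n = P W ^ (m + n) and
-- (P W ^ n) ^ m = P ^ m W ^ (m n).

open import Algebra.Bundles using (CommutativeRing; RawRing)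
open import Algebra.Morphism.Structures using (IsRingMonomorphism)
import Algebra.Morphism.RingMonomorphism as RingMonomorphism
import Algebra.Solver.Ring.AlmostCommutativeRing as AlmostCommutativeRing
open import Data.Fin using (Fin; zero; suc; #_)
open import Data.Integer as ℤ using (ℤ; +_; -[1+_]; _⊖_)
import Data.Integer.Properties as ℤ
open import Data.Maybe using (Maybe; just; nothing; map; From-just; from-just)
open import Data.Nat as ℕ using (ℕ)
import Data.Nat.Properties as ℕ
open import Data.Sign as Sign using (Sign)
open import Data.Vec using (_∷_; [])
open import Function using (id)
open import Relation.Binary.Bundles using (Setoid)
open import Relation.Binary.PropositionalEquality as ≡ using (_≡_)
open import Relation.Nullary.Decidable using (dec⇒maybe)
open import Defs

module IntegerPolynomials {c ℓ} (R : CommutativeRing c ℓ) where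

  open CommutativeRing R
  open import Algebra.Properties.Ring ring
  open import Algebra.Properties.Semiring.Mult.TCOptimised semiring renaming (_×_ to _×′_)
  open import Relation.Binary.Reasoning.Setoid setoid

  signed : Sign → Carrier → Carrier
  signed Sign.+ x = x
  signed Sign.- x = - x

  -- With the optimised ×′, fromℤ 0ℤ and fromℤ 1ℤ are 0# and 1# on the nose, so polynomial
  -- constants evaluate definitionally to the entries of I₃ and Mh1.
  fromℤ : ℤ → Carrier
  fromℤ i = signed (ℤ.sign i) (ℤ.∣ i ∣ ×′ 1#)

  signed-cong : ∀ σ {x y} → x ≈ y → signed σ x ≈ signed σ y
  signed-cong Sign.+ x≈y = x≈y
  signed-cong Sign.- x≈y = -‿cong x≈y

  signed-* : ∀ σ τ x y → signed (σ Sign.* τ) (x * y) ≈ signed σ x * signed τ y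
  signed-* Sign.+ Sign.+ x y = refl
  signed-* Sign.+ Sign.- x y = -‿distribʳ-* x y
  signed-* Sign.- Sign.+ x y = -‿distribˡ-* x y
  signed-* Sign.- Sign.- x y = begin
    x * y        ≈⟨ -‿involutive (x * y) ⟨
    - - (x * y)  ≈⟨ -‿cong (-‿distribˡ-* x y) ⟩
    - (- x * y)  ≈⟨ -‿distribʳ-* (- x) y ⟩
    - x * - y    ∎

  fromℤ-◃ : ∀ σ n → fromℤ (σ ℤ.◃ n) ≈ signed σ (n ×′ 1#)
  fromℤ-◃ Sign.+ ℕ.zero    = refl
  fromℤ-◃ Sign.+ (ℕ.suc n)   = refl
  fromℤ-◃ Sign.- ℕ.zero    = sym -0#≈0#
  fromℤ-◃ Sign.- (ℕ.suc n)   = refl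

  fromℤ-* : ∀ i j → fromℤ (i ℤ.* j) ≈ fromℤ i * fromℤ j
  fromℤ-* i j = begin
    fromℤ (σ ℤ.◃ ℤ.∣ i ∣ ℕ.* ℤ.∣ j ∣)             ≈⟨ fromℤ-◃ σ (ℤ.∣ i ∣ ℕ.* ℤ.∣ j ∣) ⟩
    signed σ ((ℤ.∣ i ∣ ℕ.* ℤ.∣ j ∣) ×′ 1#)         ≈⟨ signed-cong σ (×1-homo-* ℤ.∣ i ∣ ℤ.∣ j ∣) ⟩
    signed σ ((ℤ.∣ i ∣ ×′ 1#) * (ℤ.∣ j ∣ ×′ 1#))  ≈⟨ signed-* (ℤ.sign i) (ℤ.sign j) _ _ ⟩
    fromℤ i * fromℤ j                            ∎
    where σ = ℤ.sign i Sign.* ℤ.sign j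

  fromℤ-⊖ : ∀ m n → fromℤ (m ⊖ n) ≈ m ×′ 1# - n ×′ 1#
  fromℤ-⊖ m ℕ.zero = begin
    m ×′ 1#       ≈⟨ +-identityʳ _ ⟨
    m ×′ 1# + 0#  ≈⟨ +-congˡ -0#≈0# ⟨
    m ×′ 1# - 0#  ∎
  fromℤ-⊖ ℕ.zero (ℕ.suc n) = sym (+-identityˡ _)
  fromℤ-⊖ (ℕ.suc m) (ℕ.suc n) = begin
    fromℤ (ℕ.suc m ⊖ ℕ.suc n)            ≡⟨ ≡.cong fromℤ (ℤ.[1+m]⊖[1+n]≡m⊖n m n) ⟩
    fromℤ (m ⊖ n)                    ≈⟨ fromℤ-⊖ m n ⟩
    m ×′ 1# - n ×′ 1#                  ≈⟨ +-congʳ (xyx⁻¹≈y 1# (m ×′ 1#)) ⟨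
    1# + m ×′ 1# - 1# - n ×′ 1#        ≈⟨ +-assoc _ _ _ ⟩
    1# + m ×′ 1# + (- 1# - n ×′ 1#)    ≈⟨ +-congˡ (-‿+-comm 1# (n ×′ 1#)) ⟩
    1# + m ×′ 1# - (1# + n ×′ 1#)      ≈⟨ +-cong (×-homo-+ 1# 1 m) (-‿cong (×-homo-+ 1# 1 n)) ⟨
    ℕ.suc m ×′ 1# - ℕ.suc n ×′ 1#          ∎

  fromℤ-+ : ∀ i j → fromℤ (i ℤ.+ j) ≈ fromℤ i + fromℤ j
  fromℤ-+ (+ m)    (+ n)    = ×-homo-+ 1# m n
  fromℤ-+ (+ m)    -[1+ n ] = fromℤ-⊖ m (ℕ.suc n)
  fromℤ-+ -[1+ m ] (+ n)    = trans (fromℤ-⊖ n (ℕ.suc m)) (+-comm _ _)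
  fromℤ-+ -[1+ m ] -[1+ n ] = begin
    - (ℕ.suc (ℕ.suc m ℕ.+ n) ×′ 1#)       ≡⟨ ≡.cong (λ k → - (ℕ.suc k ×′ 1#)) (ℕ.+-suc m n) ⟨
    - ((ℕ.suc m ℕ.+ ℕ.suc n) ×′ 1#)       ≈⟨ -‿cong (×-homo-+ 1# (ℕ.suc m) (ℕ.suc n)) ⟩
    - (ℕ.suc m ×′ 1# + ℕ.suc n ×′ 1#)    ≈⟨ -‿+-comm _ _ ⟨
    - (ℕ.suc m ×′ 1#) - ℕ.suc n ×′ 1#    ∎

  fromℤ-neg : ∀ i → fromℤ (ℤ.- i) ≈ - fromℤ i
  fromℤ-neg -[1+ n ]      = sym (-‿involutive _)
  fromℤ-neg (+ ℕ.zero)    = sym -0#≈0#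
  fromℤ-neg (+ (ℕ.suc n))   = refl

  fromℤ-morphism : ℤ.+-*-rawRing AlmostCommutativeRing.-Raw-AlmostCommutative⟶
                   AlmostCommutativeRing.fromCommutativeRing R
  fromℤ-morphism = record
    { ⟦_⟧ = fromℤ ; +-homo = fromℤ-+ ; *-homo = fromℤ-* ; -‿homo = fromℤ-neg
    ; 0-homo = refl ; 1-homo = refl }

  fromℤ-≟ : ∀ i j → Maybe (fromℤ i ≈ fromℤ j)
  fromℤ-≟ i j = map (λ i≡j → reflexive (≡.cong fromℤ i≡j)) (dec⇒maybe (i ℤ.≟ j))

  open import Algebra.Solver.Ring ℤ.+-*-rawRing
    (AlmostCommutativeRing.fromCommutativeRing R) fromℤ-morphism fromℤ-≟ public

  module _ {n} (ρ : Env n) where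

    valuesAt : RawRing _ ℓ
    valuesAt = record
      { Carrier = Polynomial n ; _≈_ = λ p q → ⟦ p ⟧ ρ ≈ ⟦ q ⟧ ρ
      ; _+_ = _:+_ ; _*_ = _:*_ ; -_ = :-_ ; 0# = con ℤ.0ℤ ; 1# = con ℤ.1ℤ }

    evaluation-isRingMonomorphism : IsRingMonomorphism valuesAt rawRing (λ p → ⟦ p ⟧ ρ)
    evaluation-isRingMonomorphism = record
      { isRingHomomorphism = record
        { isSemiringHomomorphism = record
          { isNearSemiringHomomorphism = record
            { +-isMonoidHomomorphism = record
              { isMagmaHomomorphism = record
                { isRelHomomorphism = record { cong = id }
                ; homo = λ _ _ → refl }
              ; ε-homo = refl }
            ; *-homo = λ _ _ → refl }
          ; 1#-homo = refl }
        ; -‿homo = λ _ → refl }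
      ; injective = id }

    polynomialRingAt : CommutativeRing _ ℓ
    polynomialRingAt = record
      { isCommutativeRing =
          RingMonomorphism.isCommutativeRing evaluation-isRingMonomorphism isCommutativeRing }

all-Fin3? : ∀ {p} {P : Fin 3 → Set p} → (∀ i → Maybe (P i)) → Maybe (∀ i → P i)
all-Fin3? f with f zero | f (suc zero) | f (suc (suc zero))
... | just p₀ | just p₁ | just p₂ = just λ where
  zero             → p₀
  (suc zero)       → p₁
  (suc (suc zero)) → p₂
... | _ | _ | _ = nothing

module HoradamAlgebra {c₀ ℓ} (R : CommutativeRing c₀ ℓ)
  (r s t tinv a b c : CommutativeRing.Carrier R) where

  open CommutativeRing R hiding (zero)
  open Horadam R r s t tinv a b c public
  open IntegerPolynomials R using (solve; _:=_; _:+_; _:*_; con)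

  next : Mat → Mat → Mat → Mat
  next M₂ M₁ M₀ = r · M₂ ⊕ s · M₁ ⊕ t · M₀

  -- t · MH0 with t * tinv cancelled: free of tinv, so identities involving it are polynomial.
  tMH0 : Mat
  tMH0 = mat (t * b) (t * (c - r * b)) (t * (t * a))
             (t * a) (t * (b - r * a)) (t * (c - r * b - s * a))
             (c - r * b - s * a)
             (t * a - r * (c - r * b - s * a))
             (- (s * c) + (t + r * s) * b + (s * s - r * t) * a)

  ≋-refl : ∀ {X} → X ≋ X
  ≋-refl i j = refl

  ≋-sym : ∀ {X Y} → X ≋ Y → Y ≋ X
  ≋-sym X≋Y i j = sym (X≋Y i j)

  ≋-trans : ∀ {X Y Z} → X ≋ Y → Y ≋ Z → X ≋ Z
  ≋-trans X≋Y Y≋Z i j = trans (X≋Y i j) (Y≋Z i j)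

  ≋-reflexive : ∀ {X Y} → X ≡ Y → X ≋ Y
  ≋-reflexive ≡.refl = ≋-refl

  ≋-setoid : Setoid c₀ ℓ
  ≋-setoid = record
    { Carrier = Mat ; _≈_ = _≋_
    ; isEquivalence = record { refl = ≋-refl ; sym = ≋-sym ; trans = ≋-trans } }

  ⊗-cong : ∀ {X X′ Y Y′} → X ≋ X′ → Y ≋ Y′ → X ⊗ Y ≋ X′ ⊗ Y′
  ⊗-cong X≋X′ Y≋Y′ i j =
    +-cong (+-cong (*-cong (X≋X′ i zero) (Y≋Y′ zero j))
                   (*-cong (X≋X′ i (suc zero)) (Y≋Y′ (suc zero) j)))
           (*-cong (X≋X′ i (suc (suc zero))) (Y≋Y′ (suc (suc zero)) j))

  ⊗-congˡ : ∀ X {Y Y′} → Y ≋ Y′ → X ⊗ Y ≋ X ⊗ Y′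
  ⊗-congˡ X = ⊗-cong {X} ≋-refl

  ⊗-congʳ : ∀ {X X′} Y → X ≋ X′ → X ⊗ Y ≋ X′ ⊗ Y
  ⊗-congʳ Y X≋X′ = ⊗-cong X≋X′ (≋-refl {Y})

  next-cong : ∀ {A A′ B B′ C C′} → A ≋ A′ → B ≋ B′ → C ≋ C′ → next A B C ≋ next A′ B′ C′
  next-cong A≋A′ B≋B′ C≋C′ i j =
    +-cong (+-cong (*-congˡ (A≋A′ i j)) (*-congˡ (B≋B′ i j))) (*-congˡ (C≋C′ i j))

  ⊗-assoc : ∀ X Y Z → (X ⊗ Y) ⊗ Z ≋ X ⊗ (Y ⊗ Z)
  ⊗-assoc X Y Z i j = solve 15
    (λ x₀ x₁ x₂ y₀₀ y₀₁ y₀₂ y₁₀ y₁₁ y₁₂ y₂₀ y₂₁ y₂₂ z₀ z₁ z₂ →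
         (x₀ :* y₀₀ :+ x₁ :* y₁₀ :+ x₂ :* y₂₀) :* z₀
      :+ (x₀ :* y₀₁ :+ x₁ :* y₁₁ :+ x₂ :* y₂₁) :* z₁
      :+ (x₀ :* y₀₂ :+ x₁ :* y₁₂ :+ x₂ :* y₂₂) :* z₂
      :=    x₀ :* (y₀₀ :* z₀ :+ y₀₁ :* z₁ :+ y₀₂ :* z₂)
         :+ x₁ :* (y₁₀ :* z₀ :+ y₁₁ :* z₁ :+ y₁₂ :* z₂)
         :+ x₂ :* (y₂₀ :* z₀ :+ y₂₁ :* z₁ :+ y₂₂ :* z₂))
    refl (X i (# 0)) (X i (# 1)) (X i (# 2))
         (Y (# 0) (# 0)) (Y (# 0) (# 1)) (Y (# 0) (# 2))
         (Y (# 1) (# 0)) (Y (# 1) (# 1)) (Y (# 1) (# 2))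
         (Y (# 2) (# 0)) (Y (# 2) (# 1)) (Y (# 2) (# 2))
         (Z (# 0) j) (Z (# 1) j) (Z (# 2) j)

  ⊗-distribˡ-next : ∀ X A B C → X ⊗ next A B C ≋ next (X ⊗ A) (X ⊗ B) (X ⊗ C)
  ⊗-distribˡ-next X A B C i j = solve 15
    (λ r s t x₀ x₁ x₂ a₀ a₁ a₂ b₀ b₁ b₂ c₀ c₁ c₂ →
         x₀ :* (r :* a₀ :+ s :* b₀ :+ t :* c₀)
      :+ x₁ :* (r :* a₁ :+ s :* b₁ :+ t :* c₁)
      :+ x₂ :* (r :* a₂ :+ s :* b₂ :+ t :* c₂)
      :=    r :* (x₀ :* a₀ :+ x₁ :* a₁ :+ x₂ :* a₂)
         :+ s :* (x₀ :* b₀ :+ x₁ :* b₁ :+ x₂ :* b₂)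
         :+ t :* (x₀ :* c₀ :+ x₁ :* c₁ :+ x₂ :* c₂))
    refl r s t (X i (# 0)) (X i (# 1)) (X i (# 2))
         (A (# 0) j) (A (# 1) j) (A (# 2) j)
         (B (# 0) j) (B (# 1) j) (B (# 2) j)
         (C (# 0) j) (C (# 1) j) (C (# 2) j)

  ⊗-identityˡ : ∀ X → I₃ ⊗ X ≋ X
  ⊗-identityˡ X zero j = solve 3
    (λ x₀ x₁ x₂ → con ℤ.1ℤ :* x₀ :+ con ℤ.0ℤ :* x₁ :+ con ℤ.0ℤ :* x₂ := x₀)
    refl (X (# 0) j) (X (# 1) j) (X (# 2) j)
  ⊗-identityˡ X (suc zero) j = solve 3
    (λ x₀ x₁ x₂ → con ℤ.0ℤ :* x₀ :+ con ℤ.1ℤ :* x₁ :+ con ℤ.0ℤ :* x₂ := x₁)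
    refl (X (# 0) j) (X (# 1) j) (X (# 2) j)
  ⊗-identityˡ X (suc (suc zero)) j = solve 3
    (λ x₀ x₁ x₂ → con ℤ.0ℤ :* x₀ :+ con ℤ.0ℤ :* x₁ :+ con ℤ.1ℤ :* x₂ := x₂)
    refl (X (# 0) j) (X (# 1) j) (X (# 2) j)

  ⊗-identityʳ : ∀ X → X ⊗ I₃ ≋ X
  ⊗-identityʳ X i zero = solve 3
    (λ x₀ x₁ x₂ → x₀ :* con ℤ.1ℤ :+ x₁ :* con ℤ.0ℤ :+ x₂ :* con ℤ.0ℤ := x₀)
    refl (X i (# 0)) (X i (# 1)) (X i (# 2))
  ⊗-identityʳ X i (suc zero) = solve 3
    (λ x₀ x₁ x₂ → x₀ :* con ℤ.0ℤ :+ x₁ :* con ℤ.1ℤ :+ x₂ :* con ℤ.0ℤ := x₁)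
    refl (X i (# 0)) (X i (# 1)) (X i (# 2))
  ⊗-identityʳ X i (suc (suc zero)) = solve 3
    (λ x₀ x₁ x₂ → x₀ :* con ℤ.0ℤ :+ x₁ :* con ℤ.0ℤ :+ x₂ :* con ℤ.1ℤ := x₂)
    refl (X i (# 0)) (X i (# 1)) (X i (# 2))

  open import Relation.Binary.Reasoning.Setoid ≋-setoid

  ^-cong : ∀ {X Y} n → X ≋ Y → X ^ n ≋ Y ^ n
  ^-cong ℕ.zero    X≋Y = ≋-refl
  ^-cong (ℕ.suc n) X≋Y = ⊗-cong (^-cong n X≋Y) X≋Y

  ^-homo-⊗ : ∀ X m n → X ^ (m ℕ.+ n) ≋ X ^ m ⊗ X ^ n
  ^-homo-⊗ X m ℕ.zero = begin
    X ^ (m ℕ.+ 0)  ≡⟨ ≡.cong (X ^_) (ℕ.+-identityʳ m) ⟩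
    X ^ m          ≈⟨ ⊗-identityʳ (X ^ m) ⟨
    X ^ m ⊗ I₃     ∎
  ^-homo-⊗ X m (ℕ.suc n) = begin
    X ^ (m ℕ.+ ℕ.suc n)  ≡⟨ ≡.cong (X ^_) (ℕ.+-suc m n) ⟩
    X ^ (m ℕ.+ n) ⊗ X    ≈⟨ ⊗-congʳ X (^-homo-⊗ X m n) ⟩
    X ^ m ⊗ X ^ n ⊗ X    ≈⟨ ⊗-assoc (X ^ m) (X ^ n) X ⟩
    X ^ m ⊗ X ^ ℕ.suc n  ∎

  ^-assocʳ : ∀ X m n → (X ^ m) ^ n ≋ X ^ (m ℕ.* n)
  ^-assocʳ X m ℕ.zero = ≋-reflexive (≡.cong (X ^_) (≡.sym (ℕ.*-zeroʳ m)))
  ^-assocʳ X m (ℕ.suc n) = begin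
    (X ^ m) ^ n ⊗ X ^ m      ≈⟨ ⊗-congʳ (X ^ m) (^-assocʳ X m n) ⟩
    X ^ (m ℕ.* n) ⊗ X ^ m    ≈⟨ ^-homo-⊗ X (m ℕ.* n) m ⟨
    X ^ (m ℕ.* n ℕ.+ m)      ≡⟨ ≡.cong (X ^_) (ℕ.+-comm (m ℕ.* n) m) ⟩
    X ^ (m ℕ.+ m ℕ.* n)      ≡⟨ ≡.cong (X ^_) (ℕ.*-suc m n) ⟨
    X ^ (m ℕ.* ℕ.suc n)      ∎

  ⊗-^-commute : ∀ X Y n → X ⊗ Y ≋ Y ⊗ X → X ⊗ Y ^ n ≋ Y ^ n ⊗ X
  ⊗-^-commute X Y ℕ.zero _ = ≋-trans (⊗-identityʳ X) (≋-sym (⊗-identityˡ X))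
  ⊗-^-commute X Y (ℕ.suc n) XY≋YX = begin
    X ⊗ (Y ^ n ⊗ Y)    ≈⟨ ⊗-assoc X (Y ^ n) Y ⟨
    X ⊗ Y ^ n ⊗ Y      ≈⟨ ⊗-congʳ Y (⊗-^-commute X Y n XY≋YX) ⟩
    Y ^ n ⊗ X ⊗ Y      ≈⟨ ⊗-assoc (Y ^ n) X Y ⟩
    Y ^ n ⊗ (X ⊗ Y)    ≈⟨ ⊗-congˡ (Y ^ n) XY≋YX ⟩
    Y ^ n ⊗ (Y ⊗ X)    ≈⟨ ⊗-assoc (Y ^ n) Y X ⟨
    Y ^ n ⊗ Y ⊗ X      ∎

  ^-distrib-⊗ : ∀ X Y n → X ⊗ Y ≋ Y ⊗ X → (X ⊗ Y) ^ n ≋ X ^ n ⊗ Y ^ n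
  ^-distrib-⊗ X Y ℕ.zero _ = ≋-sym (⊗-identityˡ I₃)
  ^-distrib-⊗ X Y (ℕ.suc n) XY≋YX = begin
    (X ⊗ Y) ^ n ⊗ (X ⊗ Y)        ≈⟨ ⊗-congʳ (X ⊗ Y) (^-distrib-⊗ X Y n XY≋YX) ⟩
    X ^ n ⊗ Y ^ n ⊗ (X ⊗ Y)      ≈⟨ ⊗-assoc (X ^ n) (Y ^ n) (X ⊗ Y) ⟩
    X ^ n ⊗ (Y ^ n ⊗ (X ⊗ Y))    ≈⟨ ⊗-congˡ (X ^ n) (⊗-assoc (Y ^ n) X Y) ⟨
    X ^ n ⊗ (Y ^ n ⊗ X ⊗ Y)      ≈⟨ ⊗-congˡ (X ^ n) (⊗-congʳ Y (⊗-^-commute X Y n XY≋YX)) ⟨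
    X ^ n ⊗ (X ⊗ Y ^ n ⊗ Y)      ≈⟨ ⊗-congˡ (X ^ n) (⊗-assoc X (Y ^ n) Y) ⟩
    X ^ n ⊗ (X ⊗ Y ^ ℕ.suc n)    ≈⟨ ⊗-assoc (X ^ n) X (Y ^ ℕ.suc n) ⟨
    X ^ ℕ.suc n ⊗ Y ^ ℕ.suc n    ∎

  rec3-suc : ∀ M₀ M₁ M₂ n → rec3 M₀ M₁ M₂ (ℕ.suc n) ≋ rec3 M₁ M₂ (next M₂ M₁ M₀) n
  rec3-suc M₀ M₁ M₂ 0 = ≋-refl
  rec3-suc M₀ M₁ M₂ 1 = ≋-refl
  rec3-suc M₀ M₁ M₂ 2 = ≋-refl
  rec3-suc M₀ M₁ M₂ (ℕ.suc (ℕ.suc (ℕ.suc n))) =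
    next-cong (rec3-suc M₀ M₁ M₂ (ℕ.suc (ℕ.suc n))) (rec3-suc M₀ M₁ M₂ (ℕ.suc n)) (rec3-suc M₀ M₁ M₂ n)

  rec3-⊗ˡ : ∀ X {M₀ M₁ M₂ N₀ N₁ N₂} → N₀ ≋ X ⊗ M₀ → N₁ ≋ X ⊗ M₁ → N₂ ≋ X ⊗ M₂ →
            ∀ n → rec3 N₀ N₁ N₂ n ≋ X ⊗ rec3 M₀ M₁ M₂ n
  rec3-⊗ˡ X N₀≋ N₁≋ N₂≋ 0 = N₀≋
  rec3-⊗ˡ X N₀≋ N₁≋ N₂≋ 1 = N₁≋
  rec3-⊗ˡ X N₀≋ N₁≋ N₂≋ 2 = N₂≋
  rec3-⊗ˡ X {M₀} {M₁} {M₂} N₀≋ N₁≋ N₂≋ (ℕ.suc (ℕ.suc (ℕ.suc n))) = ≋-trans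
    (next-cong (rec3-⊗ˡ X N₀≋ N₁≋ N₂≋ (ℕ.suc (ℕ.suc n))) (rec3-⊗ˡ X N₀≋ N₁≋ N₂≋ (ℕ.suc n))
               (rec3-⊗ˡ X N₀≋ N₁≋ N₂≋ n))
    (≋-sym (⊗-distribˡ-next X (rec3 M₀ M₁ M₂ (ℕ.suc (ℕ.suc n))) (rec3 M₀ M₁ M₂ (ℕ.suc n)) (rec3 M₀ M₁ M₂ n)))

module HoradamNormalisation {c₀ ℓ} (R : CommutativeRing c₀ ℓ)
  (r s t tinv a b c : CommutativeRing.Carrier R) where

  open CommutativeRing R using (refl)
  open HoradamAlgebra R r s t tinv a b c
  open IntegerPolynomials R
    using (Env; var; ⟦_⟧; normalise; _≈N_; _≟N_; ⟦_⟧N-cong; prove; polynomialRingAt)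

  ρ : Env 7
  ρ = r ∷ s ∷ t ∷ tinv ∷ a ∷ b ∷ c ∷ []

  module ᴾ = HoradamAlgebra (polynomialRingAt ρ)
    (var (# 0)) (var (# 1)) (var (# 2)) (var (# 3)) (var (# 4)) (var (# 5)) (var (# 6))

  expand : Mat → Mat
  expand X = mat (X (# 0) (# 0)) (X (# 0) (# 1)) (X (# 0) (# 2))
                 (X (# 1) (# 0)) (X (# 1) (# 1)) (X (# 1) (# 2))
                 (X (# 2) (# 0)) (X (# 2) (# 1)) (X (# 2) (# 2))

  ≋-expand : ∀ X → X ≋ expand X
  ≋-expand X = λ where
    zero             zero             → refl
    zero             (suc zero)       → refl
    zero             (suc (suc zero)) → refl
    (suc zero)       zero             → refl
    (suc zero)       (suc zero)       → refl
    (suc zero)       (suc (suc zero)) → refl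
    (suc (suc zero)) zero             → refl
    (suc (suc zero)) (suc zero)       → refl
    (suc (suc zero)) (suc (suc zero)) → refl

  expand-cong : ∀ {X Y} → X ≋ Y → expand X ≋ expand Y
  expand-cong {X} {Y} X≋Y = ≋-trans (≋-sym (≋-expand X)) (≋-trans X≋Y (≋-expand Y))

  ≋-unexpand : ∀ {X Y} → expand X ≋ expand Y → X ≋ Y
  ≋-unexpand {X} {Y} X≋Y = ≋-trans (≋-expand X) (≋-trans X≋Y (≋-sym (≋-expand Y)))

  -- Expanded, so that eval (ᴾ.MH1 ᴾ.⊗ ᴾ.Mh1) and expand (MH1 ⊗ Mh1) agree definitionally.
  eval : ᴾ.Mat → Mat
  eval X = expand λ i j → ⟦ X i j ⟧ ρ

  infix 4 _≟ᴹ_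
  _≟ᴹ_ : (X Y : ᴾ.Mat) → Maybe (eval X ≋ eval Y)
  X ≟ᴹ Y = map sound (all-Fin3? λ i → all-Fin3? λ j → normalise (X i j) ≟N normalise (Y i j))
    where
    sound : (∀ i j → normalise (X i j) ≈N normalise (Y i j)) → eval X ≋ eval Y
    sound eq = expand-cong λ i j → prove ρ (X i j) (Y i j) (⟦ eq i j ⟧N-cong ρ)

  ≋-by-normalisation : ∀ X Y → From-just (X ≟ᴹ Y)
  ≋-by-normalisation X Y = from-just (X ≟ᴹ Y)

  Mh1⊗Mh1≋Mh2 : Mh1 ⊗ Mh1 ≋ Mh2
  Mh1⊗Mh1≋Mh2 = ≋-unexpand (≋-by-normalisation (ᴾ.Mh1 ᴾ.⊗ ᴾ.Mh1) ᴾ.Mh2)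

  Mh1-cayley-hamilton : Mh1 ⊗ Mh2 ≋ next Mh2 Mh1 I₃
  Mh1-cayley-hamilton =
    ≋-unexpand (≋-by-normalisation (ᴾ.Mh1 ᴾ.⊗ ᴾ.Mh2) (ᴾ.next ᴾ.Mh2 ᴾ.Mh1 ᴾ.I₃))

  MH1⊗Mh1≋MH2 : MH1 ⊗ Mh1 ≋ MH2
  MH1⊗Mh1≋MH2 = ≋-unexpand (≋-by-normalisation (ᴾ.MH1 ᴾ.⊗ ᴾ.Mh1) ᴾ.MH2)

  MH1⊗Mh2≋MH3 : MH1 ⊗ Mh2 ≋ r · MH2 ⊕ s · MH1 ⊕ tMH0
  MH1⊗Mh2≋MH3 = ≋-unexpand
    (≋-by-normalisation (ᴾ.MH1 ᴾ.⊗ ᴾ.Mh2) (var (# 0) ᴾ.· ᴾ.MH2 ᴾ.⊕ var (# 1) ᴾ.· ᴾ.MH1 ᴾ.⊕ ᴾ.tMH0))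

  MH1-Mh1-commute : MH1 ⊗ Mh1 ≋ Mh1 ⊗ MH1
  MH1-Mh1-commute = ≋-unexpand (≋-by-normalisation (ᴾ.MH1 ᴾ.⊗ ᴾ.Mh1) (ᴾ.Mh1 ᴾ.⊗ ᴾ.MH1))

module ProductsAndPowers {c₀ ℓ} (R : CommutativeRing c₀ ℓ)
  (r s t tinv a b c : CommutativeRing.Carrier R)
  (t*tinv≈1 : CommutativeRing._≈_ R (CommutativeRing._*_ R t tinv) (CommutativeRing.1# R)) where

  open CommutativeRing R hiding (zero)
  open HoradamAlgebra R r s t tinv a b c
  open HoradamNormalisation R r s t tinv a b c
    using (Mh1⊗Mh1≋Mh2; Mh1-cayley-hamilton; MH1⊗Mh1≋MH2; MH1⊗Mh2≋MH3; MH1-Mh1-commute)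
  open import Relation.Binary.Reasoning.Setoid ≋-setoid

  t*[tinv*x]≈x : ∀ x → t * (tinv * x) ≈ x
  t*[tinv*x]≈x x = trans (sym (*-assoc t tinv x)) (trans (*-congʳ t*tinv≈1) (*-identityˡ x))

  t·MH0≋tMH0 : t · MH0 ≋ tMH0
  t·MH0≋tMH0 = λ where
    zero             zero             → refl
    zero             (suc zero)       → refl
    zero             (suc (suc zero)) → refl
    (suc zero)       zero             → refl
    (suc zero)       (suc zero)       → refl
    (suc zero)       (suc (suc zero)) → refl
    (suc (suc zero)) zero             → t*[tinv*x]≈x _
    (suc (suc zero)) (suc zero)       → t*[tinv*x]≈x _
    (suc (suc zero)) (suc (suc zero)) → t*[tinv*x]≈x _

  Mh-suc : ∀ n → Mh (ℕ.suc n) ≋ Mh1 ⊗ Mh n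
  Mh-suc n = ≋-trans (rec3-suc I₃ Mh1 Mh2 n)
    (rec3-⊗ˡ Mh1 (≋-sym (⊗-identityʳ Mh1)) (≋-sym Mh1⊗Mh1≋Mh2) (≋-sym Mh1-cayley-hamilton) n)

  Mh≋Mh1^ : ∀ n → Mh n ≋ Mh1 ^ n
  Mh≋Mh1^ ℕ.zero    = ≋-refl
  Mh≋Mh1^ (ℕ.suc n) = begin
    Mh (ℕ.suc n)    ≈⟨ Mh-suc n ⟩
    Mh1 ⊗ Mh n      ≈⟨ ⊗-congˡ Mh1 (Mh≋Mh1^ n) ⟩
    Mh1 ⊗ Mh1 ^ n   ≈⟨ ⊗-^-commute Mh1 Mh1 n ≋-refl ⟩
    Mh1 ^ ℕ.suc n   ∎

  MH-suc : ∀ n → MH (ℕ.suc n) ≋ MH1 ⊗ Mh n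
  MH-suc n = ≋-trans (rec3-suc MH0 MH1 MH2 n)
    (rec3-⊗ˡ MH1 (≋-sym (⊗-identityʳ MH1)) (≋-sym MH1⊗Mh1≋MH2) MH3≋MH1⊗Mh2 n)
    where
    MH3≋MH1⊗Mh2 : next MH2 MH1 MH0 ≋ MH1 ⊗ Mh2
    MH3≋MH1⊗Mh2 i j = trans (+-congˡ (t·MH0≋tMH0 i j)) (sym (MH1⊗Mh2≋MH3 i j))

  MH-suc≋MH1⊗Mh1^ : ∀ n → MH (ℕ.suc n) ≋ MH1 ⊗ Mh1 ^ n
  MH-suc≋MH1⊗Mh1^ n = ≋-trans (MH-suc n) (⊗-congˡ MH1 (Mh≋Mh1^ n))

  Mh⊗MH-suc : ∀ m n → Mh m ⊗ MH (ℕ.suc n) ≋ MH (ℕ.suc (m ℕ.+ n))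
  Mh⊗MH-suc m n = begin
    Mh m ⊗ MH (ℕ.suc n)           ≈⟨ ⊗-cong (Mh≋Mh1^ m) (MH-suc≋MH1⊗Mh1^ n) ⟩
    Mh1 ^ m ⊗ (MH1 ⊗ Mh1 ^ n)      ≈⟨ ⊗-assoc (Mh1 ^ m) MH1 (Mh1 ^ n) ⟨
    Mh1 ^ m ⊗ MH1 ⊗ Mh1 ^ n        ≈⟨ ⊗-congʳ (Mh1 ^ n) (⊗-^-commute MH1 Mh1 m MH1-Mh1-commute) ⟨
    MH1 ⊗ Mh1 ^ m ⊗ Mh1 ^ n        ≈⟨ ⊗-assoc MH1 (Mh1 ^ m) (Mh1 ^ n) ⟩
    MH1 ⊗ (Mh1 ^ m ⊗ Mh1 ^ n)      ≈⟨ ⊗-congˡ MH1 (^-homo-⊗ Mh1 m n) ⟨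
    MH1 ⊗ Mh1 ^ (m ℕ.+ n)          ≈⟨ MH-suc≋MH1⊗Mh1^ (m ℕ.+ n) ⟨
    MH (ℕ.suc (m ℕ.+ n))          ∎

  MH-suc⊗Mh : ∀ m n → MH (ℕ.suc n) ⊗ Mh m ≋ MH (ℕ.suc (m ℕ.+ n))
  MH-suc⊗Mh m n = begin
    MH (ℕ.suc n) ⊗ Mh m            ≈⟨ ⊗-cong (MH-suc≋MH1⊗Mh1^ n) (Mh≋Mh1^ m) ⟩
    MH1 ⊗ Mh1 ^ n ⊗ Mh1 ^ m         ≈⟨ ⊗-assoc MH1 (Mh1 ^ n) (Mh1 ^ m) ⟩
    MH1 ⊗ (Mh1 ^ n ⊗ Mh1 ^ m)       ≈⟨ ⊗-congˡ MH1 (^-homo-⊗ Mh1 n m) ⟨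
    MH1 ⊗ Mh1 ^ (n ℕ.+ m)           ≡⟨ ≡.cong (λ k → MH1 ⊗ Mh1 ^ k) (ℕ.+-comm n m) ⟩
    MH1 ⊗ Mh1 ^ (m ℕ.+ n)           ≈⟨ MH-suc≋MH1⊗Mh1^ (m ℕ.+ n) ⟨
    MH (ℕ.suc (m ℕ.+ n))           ∎

  MH-suc-^ : ∀ m n → MH (ℕ.suc n) ^ m ≋ MH1 ^ m ⊗ Mh (m ℕ.* n)
  MH-suc-^ m n = begin
    MH (ℕ.suc n) ^ m                ≈⟨ ^-cong m (MH-suc≋MH1⊗Mh1^ n) ⟩
    (MH1 ⊗ Mh1 ^ n) ^ m              ≈⟨ ^-distrib-⊗ MH1 (Mh1 ^ n) m
                                         (⊗-^-commute MH1 Mh1 n MH1-Mh1-commute) ⟩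
    MH1 ^ m ⊗ (Mh1 ^ n) ^ m          ≈⟨ ⊗-congˡ (MH1 ^ m) (^-assocʳ Mh1 n m) ⟩
    MH1 ^ m ⊗ Mh1 ^ (n ℕ.* m)        ≡⟨ ≡.cong (λ k → MH1 ^ m ⊗ Mh1 ^ k) (ℕ.*-comm n m) ⟩
    MH1 ^ m ⊗ Mh1 ^ (m ℕ.* n)        ≈⟨ ⊗-congˡ (MH1 ^ m) (Mh≋Mh1^ (m ℕ.* n)) ⟨
    MH1 ^ m ⊗ Mh (m ℕ.* n)           ∎

open import Data.Nat using (ℕ; suc; _+_; _*_)
open import Data.Product using (_×_; _,_)

theorem3p3 : ∀ {c₀ ℓ} (R : CommutativeRing c₀ ℓ) →
    (r s t tinv a b c : CommutativeRing.Carrier R) →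
    CommutativeRing._≈_ R (CommutativeRing._*_ R t tinv) (CommutativeRing.1# R) →
    let open Horadam R r s t tinv a b c in
    (m n : ℕ) →
      ((Mh m ⊗ MH (suc n) ≋ MH (suc (m + n))) × (MH (suc n) ⊗ Mh m ≋ MH (suc (m + n))))
      × (MH (suc n) ^ m ≋ (MH1 ^ m) ⊗ Mh (m * n))
theorem3p3 R r s t tinv a b c t*tinv≈1 m n =
  (Mh⊗MH-suc m n , MH-suc⊗Mh m n) , MH-suc-^ m n
  where open ProductsAndPowers R r s t tinv a b c t*tinv≈1
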